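{- The rank sum oracle (Sum) is not polynomially reducible to any of the following: the minimum rank oracle (Min), the common independence oracle (CI), the maximum rank oracle (Max), and the combined oracle CI+Max.
   Context: Let $\mathbf{M}_1=(E,\mathcal{I}_1)$, $\mathbf{M}_2=(E,\mathcal{I}_2)$ be loopless matroids on a common finite ground set $E$ with rank functions $r_1,r_2$. For a queried $X\subseteq E$: Sum returns $r_1(X)+r_2(X)$; Min returns $\min\{r_1(X),r_2(X)\}$; Max returns $\max\{r_1(X),r_2(X)\}$; CI returns ``Yes'' if $X\in\mathcal{I}_1\cap\mathcal{I}_2$ and ``No'' otherwise; CI+Max returns both the CI answer and the Max answer for $X$. An oracle $\mathcal{O}_1$ is polynomially reducible to an oracle $\mathcal{O}_2$ if, for every such pair of matroids, the answer of $\mathcal{O}_1$ to any query can be computed using a number of calls to $\mathcal{O}_2$ bounded by a polynomial in $|E|$ (in particular, the answers of $\mathcal{O}_2$ must determine those of $\mathcal{O}_1$). -}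

module Defs where

open import Data.Nat using (ℕ; zero; suc; _+_; _*_; _^_; _≤_; _<_; _⊔_; _⊓_)
open import Data.Bool using (Bool; true; false; _∧_)
open import Data.Fin using (Fin)
open import Data.Fin.Subset using (Subset; ⊥; ⁅_⁆; _∈_; _∉_; _⊆_; _∪_; ∣_∣)
open import Data.Fin.Subset.Properties using (_⊆?_)
open import Data.Vec using (Vec; []; _∷_)
open import Data.List using (List; []; _∷_; map; _++_; foldr)
open import Data.Product using (Σ; ∃; _×_; _,_; proj₁; proj₂)
open import Relation.Nullary using (¬_; does)
open import Relation.Binary.PropositionalEquality using (_≡_)

record Matroid (n : ℕ) : Set where
  field
    indep    : Subset n → Bool
    indep-⊥  : indep ⊥ ≡ true
    indep-↓  : ∀ {X Y} → Y ⊆ X → indep X ≡ true → indep Y ≡ true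
    exchange : ∀ {X Y} → indep X ≡ true → indep Y ≡ true → ∣ X ∣ < ∣ Y ∣ →
               ∃ λ e → e ∈ Y × e ∉ X × indep (X ∪ ⁅ e ⁆) ≡ true

open Matroid public

Loopless : ∀ {n} → Matroid n → Set
Loopless {n} M = ∀ (e : Fin n) → indep M ⁅ e ⁆ ≡ true

allSubsets : (n : ℕ) → List (Subset n)
allSubsets zero    = [] ∷ []
allSubsets (suc n) = map (false ∷_) (allSubsets n) ++ map (true ∷_) (allSubsets n)

rank : ∀ {n} → Matroid n → Subset n → ℕ
rank {n} M X = foldr (λ Y acc → val Y ⊔ acc) 0 (allSubsets n)
  where
  val : Subset _ → ℕ
  val Y with does (Y ⊆? X) ∧ indep M Y
  ... | true  = ∣ Y ∣
  ... | false = 0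

record LooplessPair (n : ℕ) : Set where
  field
    M₁ M₂      : Matroid n
    loopless₁  : Loopless M₁
    loopless₂  : Loopless M₂

open LooplessPair public

Oracle : Set → Set
Oracle A = ∀ {n} → LooplessPair n → Subset n → A

SumO : Oracle ℕ
SumO P X = rank (M₁ P) X + rank (M₂ P) X

MinO : Oracle ℕ
MinO P X = rank (M₁ P) X ⊓ rank (M₂ P) X

MaxO : Oracle ℕ
MaxO P X = rank (M₁ P) X ⊔ rank (M₂ P) X

CIO : Oracle Bool
CIO P X = indep (M₁ P) X ∧ indep (M₂ P) X

CIMaxO : Oracle (Bool × ℕ)
CIMaxO P X = CIO P X , MaxO P X

-- Adaptive query algorithms (decision trees): ask queries q : Q,
-- receive answers a : A, eventually return a result R.

data Alg (Q A R : Set) : Set where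
  ret : R → Alg Q A R
  ask : Q → (A → Alg Q A R) → Alg Q A R

run : ∀ {Q A R} → Alg Q A R → (Q → A) → R × ℕ
run (ret r)   f = r , 0
run (ask q k) f with run (k (f q)) f
... | r , m = r , suc m

PolyReducible : ∀ {A B} → Oracle A → Oracle B → Set
PolyReducible {A} {B} O₁ O₂ =
  Σ ℕ λ c → Σ ℕ λ k → ∀ n (X : Subset n) →
    Σ (Alg (Subset n) B A) λ alg → ∀ (P : LooplessPair n) →
      proj₁ (run alg (O₂ P)) ≡ O₁ P X × proj₂ (run alg (O₂ P)) ≤ c * n ^ k + c

{-# OPTIONS --safe #-}
-- An oracle algorithm is a deterministic decision tree, so on two instances on
-- which the oracle O gives identical answers it follows the same path and
-- returns the same result, whatever the number of queries. Hence Sum does not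
-- reduce to O as soon as two pairs of loopless matroids are indistinguishable
-- by O but have different rank sums on the ground set E.
--   Min: on E = {0,1}, the pairs (U₁,₂ , free) and (U₁,₂ , U₁,₂) have the same
--   minimum rank everywhere, but r₁(E) + r₂(E) is 3 resp. 2.
--   CI, Max, CI+Max: on E = {0,1,2,3}, take (M₁ with 2 ∥ 3, M₂ with 0 ∥ 1)
--   against (M₁ with 0 ∥ 1 and 2 ∥ 3, M₂ = U₃,₄). Both have the same common
--   independent sets and the same maximum rank everywhere, but r₁(E) + r₂(E)
--   is 6 resp. 5.
module Submission where

open import Defs
open import Relation.Nullary using (¬_)
open import Data.Product using (_×_)

open import Data.Nat using (ℕ; _<_; _<?_)
import Data.Nat as ℕ
open import Data.Bool using (Bool; true; _∧_; not)
import Data.Bool as Bool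
open import Data.Vec using ([]; _∷_)
open import Data.Fin using (Fin)
open import Data.Fin.Properties using (all?; any?)
open import Data.Fin.Subset using (Subset; ⊥; ⊤; ⁅_⁆; _∈_; _∉_; _⊆_; _∪_; ∣_∣)
open import Data.Fin.Subset.Properties using (_⊆?_; _∈?_; anySubset?)
open import Data.Product using (∃; _,_; proj₁)
open import Data.Product.Properties using (×-≡,≡→≡)
open import Data.Unit using (tt)
open import Function using (_∘_)
open import Relation.Nullary using (Dec; ¬?)
open import Relation.Nullary.Decidable
  using (True; toWitness; map′; decidable-stable; _×-dec_; _→-dec_)
open import Relation.Binary.PropositionalEquality using (_≡_; _≢_; refl; sym; cong; module ≡-Reasoning)

allSubset? : ∀ {n} {P : Subset n → Set} → (∀ X → Dec (P X)) → Dec (∀ X → P X)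
allSubset? P? =
  map′ (λ ¬∃¬P X → decidable-stable (P? X) (λ ¬PX → ¬∃¬P (X , ¬PX)))
       (λ ∀P (X , ¬PX) → ¬PX (∀P X))
       (¬? (anySubset? (¬? ∘ P?)))

module MatroidAxioms {n : ℕ} (ind : Subset n → Bool) where

  DownClosed : Set
  DownClosed = ∀ X Y → Y ⊆ X → ind X ≡ true → ind Y ≡ true

  Exchange : Set
  Exchange = ∀ X Y → ind X ≡ true → ind Y ≡ true → ∣ X ∣ < ∣ Y ∣ →
             ∃ λ e → e ∈ Y × e ∉ X × ind (X ∪ ⁅ e ⁆) ≡ true

  SingletonsIndependent : Set
  SingletonsIndependent = ∀ (e : Fin n) → ind ⁅ e ⁆ ≡ true

  downClosed? : Dec DownClosed
  downClosed? = allSubset? λ X → allSubset? λ Y →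
    (Y ⊆? X) →-dec ((ind X Bool.≟ true) →-dec (ind Y Bool.≟ true))

  exchange? : Dec Exchange
  exchange? = allSubset? λ X → allSubset? λ Y →
    (ind X Bool.≟ true) →-dec ((ind Y Bool.≟ true) →-dec ((∣ X ∣ <? ∣ Y ∣) →-dec
      any? λ e → (e ∈? Y) ×-dec ¬? (e ∈? X) ×-dec (ind (X ∪ ⁅ e ⁆) Bool.≟ true)))

  singletonsIndependent? : Dec SingletonsIndependent
  singletonsIndependent? = all? λ e → ind ⁅ e ⁆ Bool.≟ true

open MatroidAxioms

record LooplessMatroidCertificate {n : ℕ} (ind : Subset n → Bool) : Set where
  field
    ∅-independent : ind ⊥ ≡ true
    isDownClosed  : True (downClosed? ind)
    hasExchange   : True (exchange? ind)
    isLoopless    : True (singletonsIndependent? ind)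

matroid : ∀ {n} (ind : Subset n → Bool) → LooplessMatroidCertificate ind → Matroid n
matroid ind c = record
  { indep    = ind
  ; indep-⊥  = ∅-independent
  ; indep-↓  = λ {X} {Y} → toWitness {a? = downClosed? ind} isDownClosed X Y
  ; exchange = λ {X} {Y} → toWitness {a? = exchange? ind} hasExchange X Y
  }
  where open LooplessMatroidCertificate c

looplessPair : ∀ {n} (ind₁ ind₂ : Subset n → Bool) →
               LooplessMatroidCertificate ind₁ → LooplessMatroidCertificate ind₂ →
               LooplessPair n
looplessPair ind₁ ind₂ c₁ c₂ = record
  { M₁        = matroid ind₁ c₁
  ; M₂        = matroid ind₂ c₂
  ; loopless₁ = toWitness (LooplessMatroidCertificate.isLoopless c₁)
  ; loopless₂ = toWitness (LooplessMatroidCertificate.isLoopless c₂)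
  }

-- For a concrete ind the decision procedures evaluate to yes, the implicit
-- arguments have type ⊤, and Agda fills them in by eta.
certificate : ∀ {n} {ind : Subset n → Bool} → ind ⊥ ≡ true →
              {d : True (downClosed? ind)} {e : True (exchange? ind)}
              {l : True (singletonsIndependent? ind)} →
              LooplessMatroidCertificate ind
certificate ∅-indep {d} {e} {l} = record
  { ∅-independent = ∅-indep ; isDownClosed = d ; hasExchange = e ; isLoopless = l }

run-cong : ∀ {Q A R} (alg : Alg Q A R) {f g : Q → A} →
           (∀ q → f q ≡ g q) → run alg f ≡ run alg g
run-cong (ret r)   f≗g = refl
run-cong (ask q k) {f} {g} f≗g rewrite f≗g q
  with run (k (g q)) f | run-cong (k (g q)) f≗g
... | r , m | refl = refl

¬reducible-if-indistinguishable :
  ∀ {A B} (O₁ : Oracle A) (O₂ : Oracle B) {n} (P P′ : LooplessPair n) (X : Subset n) →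
  (∀ q → O₂ P q ≡ O₂ P′ q) → O₁ P X ≢ O₁ P′ X → ¬ PolyReducible O₁ O₂
¬reducible-if-indistinguishable O₁ O₂ {n} P P′ X same differ (_ , _ , reduce)
  with reduce n X
... | alg , correct = differ (begin
  O₁ P X                  ≡⟨ sym (proj₁ (correct P)) ⟩
  proj₁ (run alg (O₂ P))  ≡⟨ cong proj₁ (run-cong alg same) ⟩
  proj₁ (run alg (O₂ P′)) ≡⟨ proj₁ (correct P′) ⟩
  O₁ P′ X                 ∎)
  where open ≡-Reasoning

u₁,₂ free : Subset 2 → Bool
u₁,₂ (x₀ ∷ x₁ ∷ []) = not (x₀ ∧ x₁)
free _ = true

-- The suffixes name the parallel classes: in p₂₃ the elements 2 and 3 are parallel.
p₂₃ p₀₁ p₀₁₂₃ u₃,₄ : Subset 4 → Bool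
p₂₃   (x₀ ∷ x₁ ∷ x₂ ∷ x₃ ∷ []) = not (x₂ ∧ x₃)
p₀₁   (x₀ ∷ x₁ ∷ x₂ ∷ x₃ ∷ []) = not (x₀ ∧ x₁)
p₀₁₂₃ (x₀ ∷ x₁ ∷ x₂ ∷ x₃ ∷ []) = not (x₀ ∧ x₁) ∧ not (x₂ ∧ x₃)
u₃,₄  (x₀ ∷ x₁ ∷ x₂ ∷ x₃ ∷ []) = not (x₀ ∧ x₁ ∧ x₂ ∧ x₃)

U₁,₂⊕free U₁,₂⊕U₁,₂ : LooplessPair 2
U₁,₂⊕free   = looplessPair u₁,₂ free (certificate refl) (certificate refl)
U₁,₂⊕U₁,₂   = looplessPair u₁,₂ u₁,₂ (certificate refl) (certificate refl)

P₂₃⊕P₀₁ P₀₁₂₃⊕U₃,₄ : LooplessPair 4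
P₂₃⊕P₀₁     = looplessPair p₂₃ p₀₁ (certificate refl) (certificate refl)
P₀₁₂₃⊕U₃,₄  = looplessPair p₀₁₂₃ u₃,₄ (certificate refl) (certificate refl)

min-indistinguishable : ∀ q → MinO U₁,₂⊕free q ≡ MinO U₁,₂⊕U₁,₂ q
min-indistinguishable =
  toWitness {a? = allSubset? λ q → MinO U₁,₂⊕free q ℕ.≟ MinO U₁,₂⊕U₁,₂ q} tt

ci-indistinguishable : ∀ q → CIO P₂₃⊕P₀₁ q ≡ CIO P₀₁₂₃⊕U₃,₄ q
ci-indistinguishable =
  toWitness {a? = allSubset? λ q → CIO P₂₃⊕P₀₁ q Bool.≟ CIO P₀₁₂₃⊕U₃,₄ q} tt

max-indistinguishable : ∀ q → MaxO P₂₃⊕P₀₁ q ≡ MaxO P₀₁₂₃⊕U₃,₄ q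
max-indistinguishable =
  toWitness {a? = allSubset? λ q → MaxO P₂₃⊕P₀₁ q ℕ.≟ MaxO P₀₁₂₃⊕U₃,₄ q} tt

ciMax-indistinguishable : ∀ q → CIMaxO P₂₃⊕P₀₁ q ≡ CIMaxO P₀₁₂₃⊕U₃,₄ q
ciMax-indistinguishable q = ×-≡,≡→≡ (ci-indistinguishable q , max-indistinguishable q)

theorem3p3 : ¬ PolyReducible SumO MinO × ¬ PolyReducible SumO CIO ×
               ¬ PolyReducible SumO MaxO × ¬ PolyReducible SumO CIMaxO
theorem3p3 =
    ¬reducible-if-indistinguishable SumO MinO U₁,₂⊕free U₁,₂⊕U₁,₂ E
      min-indistinguishable (λ ())
  , ¬reducible-if-indistinguishable SumO CIO P₂₃⊕P₀₁ P₀₁₂₃⊕U₃,₄ E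
      ci-indistinguishable (λ ())
  , ¬reducible-if-indistinguishable SumO MaxO P₂₃⊕P₀₁ P₀₁₂₃⊕U₃,₄ E
      max-indistinguishable (λ ())
  , ¬reducible-if-indistinguishable SumO CIMaxO P₂₃⊕P₀₁ P₀₁₂₃⊕U₃,₄ E
      ciMax-indistinguishable (λ ())
  where
  E : ∀ {n} → Subset n
  E = ⊤
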